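{- Let $\rho\geq 1$. If there exists a $\rho$-regular nut graph, then there exist infinitely many $\rho$-regular nut graphs.
   Context: All graphs are finite and simple. For a graph $G$ with 0--1 adjacency matrix $\mathbf{A}(G)$, the nullity is the multiplicity of $0$ as an eigenvalue of $\mathbf{A}(G)$. A vertex is a core vertex if it corresponds to a nonzero entry of some vector in $\ker \mathbf{A}(G)$; a core graph is a singular graph all of whose vertices are core vertices; a nut graph is a core graph of nullity one. -}

module Defs where

open import Data.Nat using (ℕ; zero; suc)
open import Data.Bool using (Bool; true; false)
open import Data.Fin using (Fin; zero; suc)
open import Data.Rational using (ℚ; 0ℚ; 1ℚ; _+_; _*_)
open import Data.Product using (Σ; _×_; ∃)
open import Relation.Binary.PropositionalEquality using (_≡_; _≢_)

record Graph (n : ℕ) : Set where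
  field
    adj   : Fin n → Fin n → Bool
    sym   : ∀ i j → adj i j ≡ adj j i
    irref : ∀ i → adj i i ≡ false
open Graph public

sumℚ : ∀ {n} → (Fin n → ℚ) → ℚ
sumℚ {zero}  f = 0ℚ
sumℚ {suc n} f = f zero + sumℚ (λ i → f (suc i))

count : ∀ {n} → (Fin n → Bool) → ℕ
count {zero}  f = zero
count {suc n} f with f zero
... | true  = suc (count (λ i → f (suc i)))
... | false = count (λ i → f (suc i))

degree : ∀ {n} → Graph n → Fin n → ℕ
degree G i = count (adj G i)

Regular : ∀ {n} → ℕ → Graph n → Set
Regular ρ G = ∀ i → degree G i ≡ ρ

boolℚ : Bool → ℚ
boolℚ true  = 1ℚ
boolℚ false = 0ℚ

A : ∀ {n} → Graph n → Fin n → Fin n → ℚ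
A G i j = boolℚ (adj G i j)

InKer : ∀ {n} → Graph n → (Fin n → ℚ) → Set
InKer G x = ∀ i → sumℚ (λ j → A G i j * x j) ≡ 0ℚ

lincomb : ∀ {n k} → (Fin k → ℚ) → (Fin k → Fin n → ℚ) → Fin n → ℚ
lincomb c b i = sumℚ (λ a → c a * b a i)

LinIndep : ∀ {n k} → (Fin k → Fin n → ℚ) → Set
LinIndep {n} {k} b = ∀ (c : Fin k → ℚ) → (∀ i → lincomb c b i ≡ 0ℚ) → ∀ a → c a ≡ 0ℚ

-- nullity of G equals k: ker A(G) has a basis of k vectors
-- (for symmetric A, multiplicity of eigenvalue 0 = dim ker A)
HasNullity : ∀ {n} → Graph n → ℕ → Set
HasNullity {n} G k =
  Σ (Fin k → Fin n → ℚ) λ b →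
    (∀ a → InKer G (b a)) × LinIndep b ×
    (∀ x → InKer G x → Σ (Fin k → ℚ) λ c → ∀ i → x i ≡ lincomb c b i)

Singular : ∀ {n} → Graph n → Set
Singular {n} G = Σ (Fin n → ℚ) λ x → InKer G x × Σ (Fin n) λ i → x i ≢ 0ℚ

CoreVertex : ∀ {n} → Graph n → Fin n → Set
CoreVertex {n} G i = Σ (Fin n → ℚ) λ x → InKer G x × x i ≢ 0ℚ

CoreGraph : ∀ {n} → Graph n → Set
CoreGraph G = Singular G × (∀ i → CoreVertex G i)

NutGraph : ∀ {n} → Graph n → Set
NutGraph G = CoreGraph G × HasNullity G 1

module Submission where

-- There is no 1-regular nut graph: the neighbour of a degree-one vertex vanishes
-- on the whole kernel (degree-one-not-core).  For ρ = d ≥ 2 we expand a ρ-regular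
-- nut graph G at a vertex v with neighbours u₀ … u_{d-1}: delete the edges at v,
-- add vertices P k, Q k (k < d), and join P k to u k, every Q k to v, and P k to
-- Q l for k ≠ l.  The resulting H is again ρ-regular with 2d more vertices, and
-- the extension  x ↦ ((1 − d)·x v at v, x elsewhere on G, x v at P k, x (u k) at Q k)
-- is an isomorphism ker A(G) ≅ ker A(H) rescaling coordinates by nonzero factors,
-- so H is again a nut graph (nut-transfer).  Iterating gives arbitrarily large ones.

open import Defs hiding (sym)
open import Data.Nat as ℕ using (ℕ; zero; suc; _≤_; _<_; z≤n; s≤s)
import Data.Nat.Properties as ℕ
open import Data.Bool using (Bool; true; false; not; if_then_else_)
open import Data.Fin using (Fin; zero; suc; splitAt; join)
import Data.Fin as Fin
open import Data.Fin.Properties using (splitAt-join; join-splitAt)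
open import Data.Rational using (ℚ; 0ℚ; 1ℚ; _+_; _*_; -_; _-_; 1/_; NonZero; NonNegative; Negative; ≢-nonZero)
open import Data.Rational.Properties hiding (_≟_)
import Data.Rational.Properties as ℚ
open import Data.Sum using (_⊎_; inj₁; inj₂)
import Data.Sum as Sum
open import Data.Product using (Σ; _×_; _,_; proj₁)
open import Data.Empty using (⊥; ⊥-elim)
open import Data.Maybe using (Maybe; just; nothing)
open import Function using (_∘_)
open import Relation.Nullary using (¬_; does; yes; no)
open import Relation.Nullary.Decidable using (dec-false; does-⇔)
open import Function.Bundles using (mk⇔)
open import Relation.Binary.PropositionalEquality
open import Tactic.RingSolver using (solve-∀)
open import Tactic.RingSolver.Core.AlmostCommutativeRing using (AlmostCommutativeRing; fromCommutativeRing)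

ℚ-ring : AlmostCommutativeRing _ _
ℚ-ring = fromCommutativeRing +-*-commutativeRing is-zero
  where
  is-zero : (x : ℚ) → Maybe (0ℚ ≡ x)
  is-zero x with 0ℚ ℚ.≟ x
  ... | yes p = just p
  ... | no _  = nothing

cancel-nonzero : ∀ {k y : ℚ} → k ≢ 0ℚ → k * y ≡ 0ℚ → y ≡ 0ℚ
cancel-nonzero {k} {y} k≢0 ky≡0 = begin
  y              ≡⟨ sym (*-identityˡ y) ⟩
  1ℚ * y         ≡⟨ cong (_* y) (sym (*-inverseˡ k)) ⟩
  (1/ k * k) * y ≡⟨ *-assoc (1/ k) k y ⟩
  1/ k * (k * y) ≡⟨ cong (1/ k *_) ky≡0 ⟩
  1/ k * 0ℚ      ≡⟨ *-zeroʳ (1/ k) ⟩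
  0ℚ             ∎
  where
  open ≡-Reasoning
  instance
    k-nonZero : NonZero k
    k-nonZero = ≢-nonZero k≢0

solve-summand : ∀ {total y rest a : ℚ} → total ≡ y + rest → a + rest ≡ 0ℚ → y ≡ total + a
solve-summand {total} {y} {rest} {a} split balance = begin
  y                              ≡⟨ identity y rest a ⟩
  ((y + rest) + a) - (a + rest)  ≡⟨ cong₂ (λ s z → (s + a) - z) (sym split) balance ⟩
  (total + a) - 0ℚ               ≡⟨ +-identityʳ (total + a) ⟩
  total + a                      ∎
  where
  open ≡-Reasoning
  identity : ∀ y rest a → y ≡ ((y + rest) + a) - (a + rest)
  identity = solve-∀ ℚ-ring

_==_ : ∀ {n} → Fin n → Fin n → Bool
i == j = does (i Fin.≟ j)

==-sym : ∀ {n} (i j : Fin n) → (i == j) ≡ (j == i)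
==-sym i j = does-⇔ (mk⇔ sym sym) (i Fin.≟ j) (j Fin.≟ i)

sum-cong : ∀ {n} {f g : Fin n → ℚ} → (∀ i → f i ≡ g i) → sumℚ f ≡ sumℚ g
sum-cong {zero}  f≗g = refl
sum-cong {suc n} f≗g = cong₂ _+_ (f≗g zero) (sum-cong (f≗g ∘ suc))

sum-zero : ∀ {n} {f : Fin n → ℚ} → (∀ i → f i ≡ 0ℚ) → sumℚ f ≡ 0ℚ
sum-zero {zero}  f≗0 = refl
sum-zero {suc n} f≗0 = trans (cong₂ _+_ (f≗0 zero) (sum-zero (f≗0 ∘ suc))) (+-identityˡ 0ℚ)

sum-0* : ∀ {n} (f : Fin n → ℚ) → sumℚ (λ i → 0ℚ * f i) ≡ 0ℚ
sum-0* f = sum-zero (λ i → *-zeroˡ (f i))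

sum-1* : ∀ {n} (f : Fin n → ℚ) → sumℚ (λ i → 1ℚ * f i) ≡ sumℚ f
sum-1* f = sum-cong (λ i → *-identityˡ (f i))

sum-+ : ∀ {n} (f g : Fin n → ℚ) → sumℚ (λ i → f i + g i) ≡ sumℚ f + sumℚ g
sum-+ {zero}  f g = sym (+-identityˡ 0ℚ)
sum-+ {suc n} f g = trans (cong ((f zero + g zero) +_) (sum-+ (f ∘ suc) (g ∘ suc)))
                          (interchange (f zero) (g zero) (sumℚ (f ∘ suc)) (sumℚ (g ∘ suc)))
  where
  interchange : ∀ a b c e → (a + b) + (c + e) ≡ (a + c) + (b + e)
  interchange = solve-∀ ℚ-ring

sum-const : ∀ {n} (c : ℚ) → sumℚ {n} (λ _ → c) ≡ sumℚ {n} (λ _ → 1ℚ) * c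
sum-const {zero}  c = sym (*-zeroˡ c)
sum-const {suc n} c = trans (cong₂ _+_ (sym (*-identityˡ c)) (sum-const {n} c))
                            (sym (*-distribʳ-+ c 1ℚ (sumℚ {n} (λ _ → 1ℚ))))

sum-⊎ : ∀ m {k} (f : Fin m ⊎ Fin k → ℚ) →
        sumℚ (f ∘ splitAt m) ≡ sumℚ (f ∘ inj₁) + sumℚ (f ∘ inj₂)
sum-⊎ zero    f = sym (+-identityˡ _)
sum-⊎ (suc m) f = trans (cong (f (inj₁ zero) +_) (sum-⊎ m (f ∘ Sum.map₁ suc)))
                        (sym (+-assoc (f (inj₁ zero)) _ _))

sum-by : ∀ {n} (b : Fin n → Bool) (f : Fin n → ℚ) →
         sumℚ f ≡ sumℚ (λ j → boolℚ (b j) * f j) + sumℚ (λ j → boolℚ (not (b j)) * f j)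
sum-by b f = trans (sum-cong (λ j → split (b j) (f j)))
                   (sum-+ (λ j → boolℚ (b j) * f j) (λ j → boolℚ (not (b j)) * f j))
  where
  split : ∀ β x → x ≡ boolℚ β * x + boolℚ (not β) * x
  split true  x = sym (trans (cong₂ _+_ (*-identityˡ x) (*-zeroˡ x)) (+-identityʳ x))
  split false x = sym (trans (cong₂ _+_ (*-zeroˡ x) (*-identityˡ x)) (+-identityˡ x))

sum-δ : ∀ {n} (c : Fin n) (f : Fin n → ℚ) → sumℚ (λ j → boolℚ (j == c) * f j) ≡ f c
sum-δ {suc n} zero    f = trans (cong₂ _+_ (*-identityˡ (f zero)) (sum-0* (f ∘ suc)))
                                (+-identityʳ (f zero))
sum-δ {suc n} (suc c) f = trans (cong₂ _+_ (*-zeroˡ (f zero)) (sum-δ c (f ∘ suc)))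
                                (+-identityˡ (f (suc c)))

sum-others : ∀ {n} (c : Fin n) (f : Fin n → ℚ) →
             sumℚ f ≡ f c + sumℚ (λ j → boolℚ (not (j == c)) * f j)
sum-others c f = trans (sum-by (_== c) f)
                       (cong (_+ sumℚ (λ j → boolℚ (not (j == c)) * f j)) (sum-δ c f))

sum-others-const : ∀ {n} (c : Fin n) (t : ℚ) →
                   sumℚ (λ j → boolℚ (not (j == c)) * t) ≡ sumℚ {n} (λ _ → 1ℚ) * t - t
sum-others-const {n} c t = begin
  rest                   ≡⟨ solve-rest t rest ⟩
  (t + rest) - t         ≡⟨ cong (_- t) (sym (sum-others c (λ _ → t))) ⟩
  sumℚ {n} (λ _ → t) - t ≡⟨ cong (_- t) (sum-const {n} t) ⟩
  sumℚ {n} (λ _ → 1ℚ) * t - t ∎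
  where
  open ≡-Reasoning
  rest = sumℚ (λ j → boolℚ (not (j == c)) * t)
  solve-rest : ∀ t r → r ≡ (t + r) - t
  solve-rest = solve-∀ ℚ-ring

-- The number k, as the rational sum of k ones, is nonnegative; for k ≥ 2 the
-- weight 1 − k used in the expansion below is therefore nonzero.
ones-nonNeg : ∀ k → NonNegative (sumℚ {k} (λ _ → 1ℚ))
ones-nonNeg zero    = _
ones-nonNeg (suc k) = nonNeg+nonNeg⇒nonNeg 1ℚ (sumℚ {k} (λ _ → 1ℚ)) {{ones-nonNeg k}}

one-minus-≢0 : ∀ {k} → 2 ≤ k → 1ℚ - sumℚ {k} (λ _ → 1ℚ) ≢ 0ℚ
one-minus-≢0 {suc (suc k)} (s≤s (s≤s z≤n)) weight≡0 =
  nonNeg≢neg 0ℚ (- (1ℚ + ones)) {{_}} {{negative}} (sym (trans (as-negation ones) weight≡0))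
  where
  ones = sumℚ {k} (λ _ → 1ℚ)
  negative : Negative (- (1ℚ + ones))
  negative = neg-pos {1ℚ + ones} (pos+nonNeg⇒pos 1ℚ ones {{ones-nonNeg k}})
  as-negation : ∀ s → - (1ℚ + s) ≡ 1ℚ - (1ℚ + (1ℚ + s))
  as-negation = solve-∀ ℚ-ring

count-unfold : ∀ {n} (f : Fin (suc n) → Bool) →
               count f ≡ (if f zero then 1 else 0) ℕ.+ count (f ∘ suc)
count-unfold f with f zero
... | true  = refl
... | false = refl

count-cong : ∀ {n} {f g : Fin n → Bool} → (∀ i → f i ≡ g i) → count f ≡ count g
count-cong {zero}          f≗g = refl
count-cong {suc n} {f} {g} f≗g rewrite count-unfold f | count-unfold g | f≗g zero =
  cong ((if g zero then 1 else 0) ℕ.+_) (count-cong (f≗g ∘ suc))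

count-false : ∀ {n} → count {n} (λ _ → false) ≡ 0
count-false {zero}  = refl
count-false {suc n} = count-false {n}

count-true : ∀ {n} → count {n} (λ _ → true) ≡ n
count-true {zero}  = refl
count-true {suc n} = cong suc (count-true {n})

count-⊎ : ∀ m {k} (f : Fin m ⊎ Fin k → Bool) →
          count (f ∘ splitAt m) ≡ count (f ∘ inj₁) ℕ.+ count (f ∘ inj₂)
count-⊎ zero    f = refl
count-⊎ (suc m) f with f (inj₁ zero)
... | true  = cong suc (count-⊎ m (f ∘ Sum.map₁ suc))
... | false = count-⊎ m (f ∘ Sum.map₁ suc)

count-δ : ∀ {n} (c : Fin n) → count (_== c) ≡ 1
count-δ {suc n} zero    = cong suc (count-false {n})
count-δ {suc n} (suc c) = count-δ c

count-others : ∀ {n} (c : Fin n) → suc (count (λ j → not (j == c))) ≡ n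
count-others {suc n} zero    = cong suc (count-true {n})
count-others {suc n} (suc c) = cong suc (count-others c)

enumerate : ∀ {n} (b : Fin n → Bool) → Fin (count b) → Fin n
enumerate {suc n} b k with b zero
enumerate {suc n} b zero    | true  = zero
enumerate {suc n} b (suc k) | true  = suc (enumerate (b ∘ suc) k)
enumerate {suc n} b k       | false = suc (enumerate (b ∘ suc) k)

enumerate-holds : ∀ {n} (b : Fin n → Bool) (k : Fin (count b)) → b (enumerate b k) ≡ true
enumerate-holds {suc n} b k with b zero in b0
enumerate-holds {suc n} b zero    | true  = b0
enumerate-holds {suc n} b (suc k) | true  = enumerate-holds (b ∘ suc) k
enumerate-holds {suc n} b k       | false = enumerate-holds (b ∘ suc) k

sum-enumerate : ∀ {n} (b : Fin n → Bool) (f : Fin n → ℚ) →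
                sumℚ (λ j → boolℚ (b j) * f j) ≡ sumℚ (f ∘ enumerate b)
sum-enumerate {zero}  b f = refl
sum-enumerate {suc n} b f with b zero
... | true  = cong₂ _+_ (*-identityˡ (f zero)) (sum-enumerate (b ∘ suc) (f ∘ suc))
... | false = trans (cong₂ _+_ (*-zeroˡ (f zero)) (sum-enumerate (b ∘ suc) (f ∘ suc)))
                    (+-identityˡ _)

count-hits : ∀ {n} (b : Fin n → Bool) (a : Fin n) →
             count (λ k → a == enumerate b k) ≡ (if b a then 1 else 0)
count-hits {suc n} b zero    with b zero
... | true  = cong suc (count-false {count (b ∘ suc)})
... | false = count-false {count (b ∘ suc)}
count-hits {suc n} b (suc a) with b zero
... | true  = count-hits (b ∘ suc) a
... | false = count-hits (b ∘ suc) a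

sum-hits : ∀ {n} (b : Fin n → Bool) (a : Fin n) (t : ℚ) →
           sumℚ (λ k → boolℚ (a == enumerate b k) * t) ≡ boolℚ (b a) * t
sum-hits {suc n} b zero    t with b zero
... | true  = trans (cong (1ℚ * t +_) (sum-0* {count (b ∘ suc)} (λ _ → t))) (+-identityʳ _)
... | false = trans (sum-0* {count (b ∘ suc)} (λ _ → t)) (sym (*-zeroˡ t))
sum-hits {suc n} b (suc a) t with b zero
... | true  = trans (cong₂ _+_ (*-zeroˡ t) (sum-hits (b ∘ suc) a t)) (+-identityˡ _)
... | false = sum-hits (b ∘ suc) a t

neighbours : ∀ {n} (G : Graph n) (v : Fin n) → Fin (degree G v) → Fin n
neighbours G v = enumerate (adj G v)

neighbour-sum : ∀ {n} (G : Graph n) (v : Fin n) (x : Fin n → ℚ) → InKer G x →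
                sumℚ (x ∘ neighbours G v) ≡ 0ℚ
neighbour-sum G v x x∈ker = trans (sym (sum-enumerate (adj G v) x)) (x∈ker v)

neighbour-≢ : ∀ {n} (G : Graph n) (v : Fin n) (k : Fin (degree G v)) → neighbours G v k ≢ v
neighbour-≢ G v k u≡v
  with trans (sym (enumerate-holds (adj G v) k)) (trans (cong (adj G v) u≡v) (irref G v))
... | ()

-- A vertex of degree one forces its neighbour to vanish on the kernel, so a
-- graph with such a vertex is not a core graph (there are no 1-regular nut graphs).
degree-one-not-core : ∀ {n} (G : Graph n) (v : Fin n) → degree G v ≡ 1 → ¬ CoreGraph G
degree-one-not-core {n} G v deg≡1 (_ , core) =
  single-neighbour deg≡1 (neighbours G v) (neighbour-sum G v)
  where
  single-neighbour : ∀ {d} → d ≡ 1 → (u : Fin d → Fin n) →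
                     (∀ x → InKer G x → sumℚ (x ∘ u) ≡ 0ℚ) → ⊥
  single-neighbour refl u sum≡0 with core (u zero)
  ... | x , x∈ker , x≢0 = x≢0 (trans (sym (+-identityʳ _)) (sum≡0 x x∈ker))

-- Graphs whose vertex set is presented as three consecutive blocks
-- Fin a ⊎ (Fin b ⊎ Fin c).  Adjacency, degrees and kernel equations can then
-- be computed block by block.

module BlockGraph (a b c : ℕ) where

  Blocks : Set
  Blocks = Fin a ⊎ (Fin b ⊎ Fin c)

  toBlocks : Fin (a ℕ.+ (b ℕ.+ c)) → Blocks
  toBlocks = Sum.map₂ (splitAt b) ∘ splitAt a

  fromBlocks : Blocks → Fin (a ℕ.+ (b ℕ.+ c))
  fromBlocks = join a (b ℕ.+ c) ∘ Sum.map₂ (join b c)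

  to-from : ∀ y → toBlocks (fromBlocks y) ≡ y
  to-from y rewrite splitAt-join a (b ℕ.+ c) (Sum.map₂ (join b c) y) with y
  ... | inj₁ i = refl
  ... | inj₂ j = cong inj₂ (splitAt-join b c j)

  from-to : ∀ i → fromBlocks (toBlocks i) ≡ i
  from-to i with splitAt a i in split-i
  ... | inj₁ j = trans (cong (join a (b ℕ.+ c)) (sym split-i)) (join-splitAt a (b ℕ.+ c) i)
  ... | inj₂ j = trans (cong (λ r → join a (b ℕ.+ c) (inj₂ r)) (join-splitAt b c j))
                       (trans (cong (join a (b ℕ.+ c)) (sym split-i)) (join-splitAt a (b ℕ.+ c) i))

  blockSum : (Blocks → ℚ) → ℚ
  blockSum f = sumℚ (f ∘ inj₁) + (sumℚ (f ∘ inj₂ ∘ inj₁) + sumℚ (f ∘ inj₂ ∘ inj₂))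

  blockCount : (Blocks → Bool) → ℕ
  blockCount f = count (f ∘ inj₁) ℕ.+ (count (f ∘ inj₂ ∘ inj₁) ℕ.+ count (f ∘ inj₂ ∘ inj₂))

  sum-blocks : (f : Blocks → ℚ) → sumℚ (f ∘ toBlocks) ≡ blockSum f
  sum-blocks f = trans (sum-⊎ a (f ∘ Sum.map₂ (splitAt b)))
                       (cong (sumℚ (f ∘ inj₁) +_) (sum-⊎ b (f ∘ inj₂)))

  count-blocks : (f : Blocks → Bool) → count (f ∘ toBlocks) ≡ blockCount f
  count-blocks f = trans (count-⊎ a (f ∘ Sum.map₂ (splitAt b)))
                         (cong (count (f ∘ inj₁) ℕ.+_) (count-⊎ b (f ∘ inj₂)))

  blockGraph : (r : Blocks → Blocks → Bool) → (∀ y y′ → r y y′ ≡ r y′ y) →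
               (∀ y → r y y ≡ false) → Graph (a ℕ.+ (b ℕ.+ c))
  blockGraph r r-sym r-irr = record
    { adj   = λ i j → r (toBlocks i) (toBlocks j)
    ; sym   = λ i j → r-sym (toBlocks i) (toBlocks j)
    ; irref = λ i → r-irr (toBlocks i)
    }

  module _ (r : Blocks → Blocks → Bool) (r-sym : ∀ y y′ → r y y′ ≡ r y′ y)
           (r-irr : ∀ y → r y y ≡ false) where

    private
      H = blockGraph r r-sym r-irr

    blockRow : Blocks → (Blocks → ℚ) → ℚ
    blockRow y w = blockSum (λ y′ → boolℚ (r y y′) * w y′)

    regular-blocks : ∀ {ρ} → (∀ y → blockCount (r y) ≡ ρ) → Regular ρ H
    regular-blocks deg i = trans (count-blocks (r (toBlocks i))) (deg (toBlocks i))

    ker-from-blocks : (w : Blocks → ℚ) → (∀ y → blockRow y w ≡ 0ℚ) → InKer H (w ∘ toBlocks)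
    ker-from-blocks w rows i =
      trans (sum-blocks (λ y′ → boolℚ (r (toBlocks i) y′) * w y′)) (rows (toBlocks i))

    ker-to-blocks : (z : Fin (a ℕ.+ (b ℕ.+ c)) → ℚ) → InKer H z →
                    ∀ y → blockRow y (z ∘ fromBlocks) ≡ 0ℚ
    ker-to-blocks z z∈ker y = begin
      blockRow y (z ∘ fromBlocks)
        ≡⟨ cong (λ y′ → blockRow y′ (z ∘ fromBlocks)) (sym (to-from y)) ⟩
      blockRow (toBlocks (fromBlocks y)) (z ∘ fromBlocks)
        ≡⟨ sym (sum-blocks (λ y′ → boolℚ (r (toBlocks (fromBlocks y)) y′) * z (fromBlocks y′))) ⟩
      sumℚ (λ j → A H (fromBlocks y) j * z (fromBlocks (toBlocks j)))
        ≡⟨ sum-cong (λ j → cong (A H (fromBlocks y) j *_) (cong z (from-to j))) ⟩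
      sumℚ (λ j → A H (fromBlocks y) j * z j)
        ≡⟨ z∈ker (fromBlocks y) ⟩
      0ℚ ∎
      where open ≡-Reasoning

-- If E maps ker A(G) into ker A(H) and onto it, then E is a linear
-- isomorphism of the kernels that preserves supports, so H is a nut graph whenever G is.
nut-transfer : ∀ {n N} (G : Graph n) (H : Graph N) (E : (Fin n → ℚ) → Fin N → ℚ)
               (κ : Fin N → ℚ) (π : Fin N → Fin n) →
               (∀ x i → E x i ≡ κ i * x (π i)) → (∀ i → κ i ≢ 0ℚ) →
               (∀ g → Σ (Fin N) λ i → π i ≡ g) →
               (∀ x → InKer G x → InKer H (E x)) →
               (∀ z → InKer H z → Σ (Fin n → ℚ) λ x → InKer G x × (∀ i → z i ≡ E x i)) →
               NutGraph G → NutGraph H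
nut-transfer {n} {N} G H E κ π E-scales κ≢0 π-onto E-ker E-onto
             (((_ , _ , g₀ , _) , core-G) , (basis , basis-ker , basis-indep , basis-spans)) =
  (singular-H , core-H) , (E ∘ basis , E-ker _ ∘ basis-ker , indep-H , spans-H)
  where
  swap : ∀ k c y → k * (c * y) ≡ c * (k * y)
  swap = solve-∀ ℚ-ring

  core-H : ∀ i → CoreVertex H i
  core-H i with core-G (π i)
  ... | x , x∈ker , x≢0 = E x , E-ker x x∈ker , λ Ex≡0 →
    x≢0 (cancel-nonzero (κ≢0 i) (trans (sym (E-scales x i)) Ex≡0))

  singular-H : Singular H
  singular-H with π-onto g₀
  ... | i , _ with core-H i
  ... | z , z∈ker , z≢0 = z , z∈ker , i , z≢0

  indep-H : LinIndep (E ∘ basis)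
  indep-H coeff comb≡0 = basis-indep coeff comb-G≡0
    where
    comb-G≡0 : ∀ g → coeff zero * basis zero g + 0ℚ ≡ 0ℚ
    comb-G≡0 g with π-onto g
    ... | i , refl = trans (+-identityʳ _) (cancel-nonzero (κ≢0 i) (begin
      κ i * (coeff zero * basis zero (π i))  ≡⟨ swap (κ i) (coeff zero) (basis zero (π i)) ⟩
      coeff zero * (κ i * basis zero (π i))  ≡⟨ cong (coeff zero *_) (sym (E-scales (basis zero) i)) ⟩
      coeff zero * E (basis zero) i          ≡⟨ sym (+-identityʳ _) ⟩
      coeff zero * E (basis zero) i + 0ℚ     ≡⟨ comb≡0 i ⟩
      0ℚ                                     ∎))
      where open ≡-Reasoning

  spans-H : ∀ z → InKer H z → Σ (Fin 1 → ℚ) λ coeff → ∀ i → z i ≡ lincomb coeff (E ∘ basis) i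
  spans-H z z∈ker with E-onto z z∈ker
  ... | x , x∈ker , z≡Ex with basis-spans x x∈ker
  ... | coeff , x≡comb = coeff , λ i → begin
    z i                                     ≡⟨ trans (z≡Ex i) (E-scales x i) ⟩
    κ i * x (π i)                           ≡⟨ cong (κ i *_) (trans (x≡comb (π i)) (+-identityʳ _)) ⟩
    κ i * (coeff zero * basis zero (π i))   ≡⟨ swap (κ i) (coeff zero) (basis zero (π i)) ⟩
    coeff zero * (κ i * basis zero (π i))   ≡⟨ cong (coeff zero *_) (sym (E-scales (basis zero) i)) ⟩
    coeff zero * E (basis zero) i           ≡⟨ sym (+-identityʳ _) ⟩
    lincomb coeff (E ∘ basis) i             ∎
    where open ≡-Reasoning

pattern O a = inj₁ a
pattern P k = inj₂ (inj₁ k)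
pattern Q k = inj₂ (inj₂ k)

module Expansion (m : ℕ) (G : Graph (suc m)) where

  n : ℕ
  n = suc m

  d : ℕ
  d = degree G zero

  u : Fin d → Fin n
  u = neighbours G zero

  open BlockGraph n d d

  adjO : Fin n → Fin n → Bool
  adjO zero    _       = false
  adjO (suc a) zero    = false
  adjO (suc a) (suc c) = adj G (suc a) (suc c)

  adjO-sym : ∀ a c → adjO a c ≡ adjO c a
  adjO-sym zero    zero    = refl
  adjO-sym zero    (suc c) = refl
  adjO-sym (suc a) zero    = refl
  adjO-sym (suc a) (suc c) = Graph.sym G (suc a) (suc c)

  adjH : Blocks → Blocks → Bool
  adjH (O a) (O c) = adjO a c
  adjH (O a) (P k) = a == u k
  adjH (O a) (Q k) = a == zero
  adjH (P k) (O c) = c == u k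
  adjH (P k) (P l) = false
  adjH (P k) (Q l) = not (l == k)
  adjH (Q k) (O c) = c == zero
  adjH (Q k) (P l) = not (k == l)
  adjH (Q k) (Q l) = false

  adjH-sym : ∀ y y′ → adjH y y′ ≡ adjH y′ y
  adjH-sym (O a) (O c) = adjO-sym a c
  adjH-sym (O a) (P k) = refl
  adjH-sym (O a) (Q k) = refl
  adjH-sym (P k) (O c) = refl
  adjH-sym (P k) (P l) = refl
  adjH-sym (P k) (Q l) = refl
  adjH-sym (Q k) (O c) = refl
  adjH-sym (Q k) (P l) = refl
  adjH-sym (Q k) (Q l) = refl

  adjH-irr : ∀ y → adjH y y ≡ false
  adjH-irr (O zero)    = refl
  adjH-irr (O (suc a)) = irref G (suc a)
  adjH-irr (P k)       = refl
  adjH-irr (Q k)       = refl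

  H : Graph (n ℕ.+ (d ℕ.+ d))
  H = blockGraph adjH adjH-sym adjH-irr

  u≢v : ∀ k → (zero == u k) ≡ false
  u≢v k = dec-false (zero Fin.≟ u k) (λ v≡u → neighbour-≢ G zero k (sym v≡u))

  at-neighbour : ∀ (f g : Fin n → ℚ) → (∀ a → f (suc a) ≡ g (suc a)) → ∀ k → f (u k) ≡ g (u k)
  at-neighbour f g f≗g k with u k | neighbour-≢ G zero k
  ... | zero  | u≢v = ⊥-elim (u≢v refl)
  ... | suc a | _   = f≗g a

  -- Degrees: v keeps its d neighbours (now Q₀ … Q_{d-1}); a neighbour u k trades
  -- v for P k; P k and Q k have one neighbour in O and d − 1 in the other block.
  block-degree : ∀ {ρ} → Regular ρ G → ∀ y → blockCount (adjH y) ≡ ρ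
  block-degree reg (O zero) =
    trans (cong₂ ℕ._+_ (count-false {n})
                       (cong₂ ℕ._+_ (trans (count-cong u≢v) (count-false {d})) (count-true {d})))
          (reg zero)
  block-degree {ρ} reg (O (suc a)) = begin
    rest ℕ.+ (count (λ k → suc a == u k) ℕ.+ count {d} (λ _ → false))
      ≡⟨ cong (rest ℕ.+_) (cong₂ ℕ._+_ (count-hits (adj G zero) (suc a)) (count-false {d})) ⟩
    rest ℕ.+ ((if adj G zero (suc a) then 1 else 0) ℕ.+ 0)
      ≡⟨ cong (λ β → rest ℕ.+ ((if β then 1 else 0) ℕ.+ 0)) (Graph.sym G zero (suc a)) ⟩
    rest ℕ.+ ((if adj G (suc a) zero then 1 else 0) ℕ.+ 0)
      ≡⟨ cong (rest ℕ.+_) (ℕ.+-identityʳ _) ⟩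
    rest ℕ.+ (if adj G (suc a) zero then 1 else 0)
      ≡⟨ ℕ.+-comm rest _ ⟩
    (if adj G (suc a) zero then 1 else 0) ℕ.+ rest
      ≡⟨ sym (count-unfold (adj G (suc a))) ⟩
    degree G (suc a)
      ≡⟨ reg (suc a) ⟩
    ρ ∎
    where
    open ≡-Reasoning
    rest = count (λ c → adj G (suc a) (suc c))
  block-degree reg (P k) =
    trans (cong₂ ℕ._+_ (count-δ (u k)) (cong (ℕ._+ count (λ l → not (l == k))) (count-false {d})))
          (trans (count-others k) (reg zero))
  block-degree {ρ} reg (Q k) = begin
    count {n} (λ c → c == zero) ℕ.+ (count {d} (λ l → not (k == l)) ℕ.+ count {d} (λ _ → false))
      ≡⟨ cong₂ ℕ._+_ (count-δ {n} zero)
                     (cong₂ ℕ._+_ (count-cong (λ l → cong not (==-sym k l))) (count-false {d})) ⟩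
    suc (count {d} (λ l → not (l == k)) ℕ.+ 0)
      ≡⟨ cong suc (ℕ.+-identityʳ _) ⟩
    suc (count {d} (λ l → not (l == k)))
      ≡⟨ count-others k ⟩
    d
      ≡⟨ reg zero ⟩
    ρ ∎
    where open ≡-Reasoning

  regular-H : ∀ {ρ} → Regular ρ G → Regular ρ H
  regular-H reg = regular-blocks adjH adjH-sym adjH-irr (block-degree reg)

  row : Blocks → (Blocks → ℚ) → ℚ
  row = blockRow adjH adjH-sym adjH-irr

  row-O-v : ∀ w → row (O zero) w ≡ sumℚ (w ∘ Q)
  row-O-v w = begin
    sumℚ {n} (λ c → 0ℚ * w (O c)) + (sumℚ (λ k → boolℚ (zero == u k) * w (P k))
                                      + sumℚ (λ k → 1ℚ * w (Q k)))
      ≡⟨ cong₂ _+_ (sum-0* (w ∘ O))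
                   (cong₂ _+_ (trans (sum-cong (λ k → cong (λ β → boolℚ β * w (P k)) (u≢v k)))
                                     (sum-0* (w ∘ P)))
                              (sum-1* (w ∘ Q))) ⟩
    0ℚ + (0ℚ + sumℚ (w ∘ Q))
      ≡⟨ trans (+-identityˡ _) (+-identityˡ _) ⟩
    sumℚ (w ∘ Q) ∎
    where open ≡-Reasoning

  row-O-other : ∀ a w (x : Fin n → ℚ) → (∀ k → w (P k) ≡ x zero) → (∀ c → w (O (suc c)) ≡ x (suc c)) →
                row (O (suc a)) w ≡ sumℚ (λ j → A G (suc a) j * x j)
  row-O-other a w x w-P w-O = begin
    (0ℚ * w (O zero) + sumℚ (λ c → A G (suc a) (suc c) * w (O (suc c))))
      + (sumℚ (λ k → boolℚ (suc a == u k) * w (P k)) + sumℚ (λ k → 0ℚ * w (Q k)))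
      ≡⟨ cong₂ _+_ O-part P-part ⟩
    rest + sumℚ (λ k → boolℚ (suc a == u k) * x zero)
      ≡⟨ cong (rest +_) (sum-hits (adj G zero) (suc a) (x zero)) ⟩
    rest + boolℚ (adj G zero (suc a)) * x zero
      ≡⟨ cong (λ β → rest + boolℚ β * x zero) (Graph.sym G zero (suc a)) ⟩
    rest + A G (suc a) zero * x zero
      ≡⟨ +-comm rest _ ⟩
    sumℚ (λ j → A G (suc a) j * x j) ∎
    where
    open ≡-Reasoning
    rest = sumℚ (λ c → A G (suc a) (suc c) * x (suc c))
    rest-w = sumℚ (λ c → A G (suc a) (suc c) * w (O (suc c)))

    O-part : 0ℚ * w (O zero) + rest-w ≡ rest
    O-part = trans (cong (_+ rest-w) (*-zeroˡ (w (O zero))))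
                   (trans (+-identityˡ rest-w) (sum-cong (λ c → cong (A G (suc a) (suc c) *_) (w-O c))))

    P-part : sumℚ (λ k → boolℚ (suc a == u k) * w (P k)) + sumℚ (λ k → 0ℚ * w (Q k))
             ≡ sumℚ (λ k → boolℚ (suc a == u k) * x zero)
    P-part = trans (cong₂ _+_ (sum-cong (λ k → cong (boolℚ (suc a == u k) *_) (w-P k))) (sum-0* (w ∘ Q)))
                   (+-identityʳ _)

  row-P : ∀ k w → row (P k) w ≡ w (O (u k)) + sumℚ (λ l → boolℚ (not (l == k)) * w (Q l))
  row-P k w = cong₂ _+_ (sum-δ (u k) (w ∘ O))
                        (trans (cong (_+ sumℚ (λ l → boolℚ (not (l == k)) * w (Q l))) (sum-0* (w ∘ P)))
                               (+-identityˡ _))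

  row-Q : ∀ k w → row (Q k) w ≡ w (O zero) + sumℚ (λ l → boolℚ (not (l == k)) * w (P l))
  row-Q k w = cong₂ _+_ (sum-δ zero (w ∘ O))
                        (trans (cong₂ _+_ (sum-cong (λ l → cong (λ β → boolℚ (not β) * w (P l)) (==-sym k l)))
                                          (sum-0* (w ∘ Q)))
                               (+-identityʳ _))

  weight : ℚ
  weight = 1ℚ - sumℚ {d} (λ _ → 1ℚ)

  ext : (Fin n → ℚ) → Blocks → ℚ
  ext x (O zero)    = weight * x zero
  ext x (O (suc a)) = x (suc a)
  ext x (P k)       = x zero
  ext x (Q k)       = x (u k)

  ext-ker : ∀ x → InKer G x → ∀ y → row y (ext x) ≡ 0ℚ
  ext-ker x x∈ker (O zero)    = trans (row-O-v (ext x)) (neighbour-sum G zero x x∈ker)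
  ext-ker x x∈ker (O (suc a)) = trans (row-O-other a (ext x) x (λ _ → refl) (λ _ → refl)) (x∈ker (suc a))
  ext-ker x x∈ker (P k) = begin
    row (P k) (ext x)         ≡⟨ row-P k (ext x) ⟩
    ext x (O (u k)) + others  ≡⟨ cong (_+ others) (at-neighbour (ext x ∘ O) x (λ _ → refl) k) ⟩
    x (u k) + others          ≡⟨ sym (sum-others k (x ∘ u)) ⟩
    sumℚ (x ∘ u)              ≡⟨ neighbour-sum G zero x x∈ker ⟩
    0ℚ                        ∎
    where
    open ≡-Reasoning
    others = sumℚ (λ l → boolℚ (not (l == k)) * x (u l))
  ext-ker x x∈ker (Q k) = begin
    row (Q k) (ext x)                                        ≡⟨ row-Q k (ext x) ⟩
    weight * x zero + sumℚ (λ l → boolℚ (not (l == k)) * x zero)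
      ≡⟨ cong (weight * x zero +_) (sum-others-const k (x zero)) ⟩
    weight * x zero + (sumℚ {d} (λ _ → 1ℚ) * x zero - x zero) ≡⟨ cancels (sumℚ {d} (λ _ → 1ℚ)) (x zero) ⟩
    0ℚ                                                       ∎
    where
    open ≡-Reasoning
    cancels : ∀ D t → (1ℚ - D) * t + (D * t - t) ≡ 0ℚ
    cancels = solve-∀ ℚ-ring

  -- Conversely, every kernel vector w of H (given d ≥ 1) is constant t on the
  -- P-block, equals x (u k) at Q k, and is the extension of its restriction
  -- x = (t at v, w on O elsewhere), which lies in ker A(G).
  module Restriction (k₀ : Fin d) (w : Blocks → ℚ) (w∈ker : ∀ y → row y w ≡ 0ℚ) where

    t : ℚ
    t = w (P k₀)

    P-value : ∀ k → w (P k) ≡ sumℚ (w ∘ P) + w (O zero)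
    P-value k = solve-summand (sum-others k (w ∘ P)) (trans (sym (row-Q k w)) (w∈ker (Q k)))

    P-constant : ∀ k → w (P k) ≡ t
    P-constant k = trans (P-value k) (sym (P-value k₀))

    Q-total : sumℚ (w ∘ Q) ≡ 0ℚ
    Q-total = trans (sym (row-O-v w)) (w∈ker (O zero))

    Q-value : ∀ k → w (Q k) ≡ w (O (u k))
    Q-value k = trans (solve-summand (sum-others k (w ∘ Q)) (trans (sym (row-P k w)) (w∈ker (P k))))
                      (trans (cong (_+ w (O (u k))) Q-total) (+-identityˡ _))

    O-v-value : w (O zero) ≡ weight * t
    O-v-value = begin
      w (O zero)                                    ≡⟨ isolate (w (O zero)) D t ⟩
      (w (O zero) + (D * t - t)) + weight * t       ≡⟨ cong (_+ weight * t) balance ⟩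
      0ℚ + weight * t                               ≡⟨ +-identityˡ _ ⟩
      weight * t                                    ∎
      where
      open ≡-Reasoning
      D = sumℚ {d} (λ _ → 1ℚ)
      isolate : ∀ a D t → a ≡ (a + (D * t - t)) + (1ℚ - D) * t
      isolate = solve-∀ ℚ-ring
      balance : w (O zero) + (D * t - t) ≡ 0ℚ
      balance = trans (cong (w (O zero) +_)
                            (sym (trans (sum-cong (λ l → cong (boolℚ (not (l == k₀)) *_) (P-constant l)))
                                        (sum-others-const k₀ t))))
                      (trans (sym (row-Q k₀ w)) (w∈ker (Q k₀)))

    x : Fin n → ℚ
    x zero    = t
    x (suc a) = w (O (suc a))

    x-at-u : ∀ k → x (u k) ≡ w (O (u k))
    x-at-u = at-neighbour x (w ∘ O) (λ _ → refl)

    x∈ker : InKer G x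
    x∈ker zero = begin
      sumℚ (λ j → A G zero j * x j) ≡⟨ sum-enumerate (adj G zero) x ⟩
      sumℚ (x ∘ u)                  ≡⟨ sum-cong (λ k → trans (x-at-u k) (sym (Q-value k))) ⟩
      sumℚ (w ∘ Q)                  ≡⟨ Q-total ⟩
      0ℚ                            ∎
      where open ≡-Reasoning
    x∈ker (suc a) = trans (sym (row-O-other a w x P-constant (λ _ → refl))) (w∈ker (O (suc a)))

    w≡ext : ∀ y → w y ≡ ext x y
    w≡ext (O zero)    = O-v-value
    w≡ext (O (suc a)) = refl
    w≡ext (P k)       = P-constant k
    w≡ext (Q k)       = trans (Q-value k) (sym (x-at-u k))

  scale : Blocks → ℚ
  scale (O zero)    = weight
  scale (O (suc a)) = 1ℚ
  scale (P k)       = 1ℚ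
  scale (Q k)       = 1ℚ

  origin : Blocks → Fin n
  origin (O a) = a
  origin (P k) = zero
  origin (Q k) = u k

  ext-scales : ∀ x y → ext x y ≡ scale y * x (origin y)
  ext-scales x (O zero)    = refl
  ext-scales x (O (suc a)) = sym (*-identityˡ _)
  ext-scales x (P k)       = sym (*-identityˡ _)
  ext-scales x (Q k)       = sym (*-identityˡ _)

  scale-≢0 : 2 ≤ d → ∀ y → scale y ≢ 0ℚ
  scale-≢0 2≤d (O zero)    = one-minus-≢0 2≤d
  scale-≢0 2≤d (O (suc a)) = λ ()
  scale-≢0 2≤d (P k)       = λ ()
  scale-≢0 2≤d (Q k)       = λ ()

  nut-H : 2 ≤ d → NutGraph G → NutGraph H
  nut-H 2≤d = nut-transfer G H (λ x → ext x ∘ toBlocks) (scale ∘ toBlocks) (origin ∘ toBlocks)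
    (λ x → ext-scales x ∘ toBlocks) (scale-≢0 2≤d ∘ toBlocks) origin-onto
    (λ x x∈ker → ker-from-blocks adjH adjH-sym adjH-irr (ext x) (ext-ker x x∈ker))
    ext-onto
    where
    k₀ : Fin d
    k₀ = Fin.fromℕ< (ℕ.≤-trans (s≤s z≤n) 2≤d)

    origin-onto : ∀ g → Σ (Fin (n ℕ.+ (d ℕ.+ d))) λ i → origin (toBlocks i) ≡ g
    origin-onto zero    = fromBlocks (P k₀) , cong origin (to-from (P k₀))
    origin-onto (suc a) = fromBlocks (O (suc a)) , cong origin (to-from (O (suc a)))

    ext-onto : ∀ z → InKer H z →
               Σ (Fin n → ℚ) λ x → InKer G x × (∀ i → z i ≡ ext x (toBlocks i))
    ext-onto z z∈ker = x , x∈ker , λ i → trans (cong z (sym (from-to i))) (w≡ext (toBlocks i))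
      where open Restriction k₀ (z ∘ fromBlocks) (ker-to-blocks adjH adjH-sym adjH-irr z z∈ker)

-- One step: a ρ-regular nut graph (ρ ≥ 1) yields a strictly larger one.  A nut
-- graph has a vertex, ρ = 1 is impossible, and for ρ ≥ 2 the expansion at vertex 0
-- adds 2ρ vertices.
larger-regular-nut : ∀ {ρ n} (G : Graph n) → 1 ≤ ρ → Regular ρ G → NutGraph G →
                     Σ ℕ λ n′ → n < n′ × Σ (Graph n′) λ H → Regular ρ H × NutGraph H
larger-regular-nut {n = zero} G _ _ ((( _ , _ , () , _) , _) , _)
larger-regular-nut {1} {suc m} G _ reg nut = ⊥-elim (degree-one-not-core G zero (reg zero) (proj₁ nut))
larger-regular-nut {suc (suc k)} {suc m} G _ reg nut =
  suc m ℕ.+ (d ℕ.+ d) , ℕ.m<m+n (suc m) d+d>0 , H , regular-H reg , nut-H 2≤d nut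
  where
  open Expansion m G
  2≤d : 2 ≤ d
  2≤d = subst (2 ≤_) (sym (reg zero)) (s≤s (s≤s z≤n))
  d+d>0 : 0 < d ℕ.+ d
  d+d>0 = ℕ.≤-trans (s≤s z≤n) (ℕ.≤-trans 2≤d (ℕ.m≤m+n d d))

unbounded : (S : ℕ → Set) → (∀ n → S n → Σ ℕ λ n′ → n < n′ × S n′) →
            Σ ℕ S → ∀ N → Σ ℕ λ n → N < n × S n
unbounded S grow (n , s) zero with grow n s
... | n′ , n<n′ , s′ = n′ , ℕ.≤-<-trans z≤n n<n′ , s′
unbounded S grow start (suc N) with unbounded S grow start N
... | n , N<n , s with grow n s
... | n′ , n<n′ , s′ = n′ , ℕ.≤-<-trans N<n n<n′ , s′

proposition3 : (ρ : ℕ) → 1 ≤ ρ →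
    Σ ℕ (λ n → Σ (Graph n) λ G → Regular ρ G × NutGraph G) →
    (N : ℕ) → Σ ℕ (λ n → N < n × Σ (Graph n) λ G → Regular ρ G × NutGraph G)
proposition3 ρ 1≤ρ = unbounded (λ n → Σ (Graph n) λ G → Regular ρ G × NutGraph G)
  (λ n (G , reg , nut) → larger-regular-nut G 1≤ρ reg nut)
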